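{- If $r$ is a closed term with $r:A$ for some type $A$, and $r$ is in normal form with respect to $\rightsquigarrow$ (there is no $s$ with $r\rightsquigarrow s$), then $r$ is an introduction (an abstraction or a product).
   Context: Types are generated by $A ::= \tau \mid A\Rightarrow A \mid A\wedge A$, where $\tau$ is the only atomic type ($\Rightarrow$ associates to the right). Type equivalence $\equiv$ is the smallest congruence on types such that $A\wedge B\equiv B\wedge A$, $A\wedge(B\wedge C)\equiv(A\wedge B)\wedge C$, $A\Rightarrow(B\wedge C)\equiv(A\Rightarrow B)\wedge(A\Rightarrow C)$ and $(A\wedge B)\Rightarrow C\equiv A\Rightarrow B\Rightarrow C$. To each type $A$ is associated an infinite set of variables $\mathcal V_A$, with $\mathcal V_A=\mathcal V_B$ if $A\equiv B$ and $\mathcal V_A\cap\mathcal V_B=\emptyset$ otherwise. Preterms are $r ::= x \mid \lambda x.r \mid rr \mid r\times r \mid \pi_A(r)$ (application left associative); one writes $\lambda x^A.r$ for $\lambda x.r$ when $x\in\mathcal V_A$. Introductions are abstractions and products; eliminations are applications and projections. Substitution $r[s/x]$ is as usual; a term is closed if it has no free variables. Typing $r:A$ (without contexts): $x:A$ if $x\in\mathcal V_A$; if $r:A$ and $A\equiv B$ then $r:B$; if $r:B$ then $\lambda x^A.r:A\Rightarrow B$; if $r:A\Rightarrow B$ and $s:A$ then $rs:B$; if $r:A$ and $s:B$ then $r\times s:A\wedge B$; if $r:A\wedge B$ then $\pi_A(r):A$. Terms are well-typed preterms. $\rightleftarrows$ is the smallest symmetric relation, closed under all term contexts, containing $r\times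 s\rightleftarrows s\times r$, $(r\times s)\times t\rightleftarrows r\times(s\times t)$, $\lambda x^A.(r\times s)\rightleftarrows \lambda x^A.r\times\lambda x^A.s$, $rst\rightleftarrows r(s\times t)$; $\rightleftarrows^*$ is its reflexive transitive closure. Reduction: $\to_{\beta\pi\zeta}$: if $s:A$ then $(\lambda x^A.r)s\to_{\beta\pi\zeta} r[s/x]$; if $r:A$ then $\pi_A(r\times s)\to_{\beta\pi\zeta} r$; $(r\times s)t\to_{\beta\pi\zeta} rt\times st$. $\to_{\eta\delta}$: if $r:A\Rightarrow B$, $r$ is an elimination or a variable, and $x\in\mathcal V_A$ fresh, then $r\to_{\eta\delta}\lambda x^A.(rx)$; if $r:A\wedge B$ and $r$ is an elimination or a variable, then $r\to_{\eta\delta}\pi_A(r)\times\pi_B(r)$. The relations $\hookrightarrow$ and $\to$ are the smallest relations such that: $r\to_{\beta\pi\zeta}s$ implies $r\hookrightarrow s$; $r\to_{\eta\delta}s$ implies $r\to s$; $r\hookrightarrow s$ implies $r\to s$; $r\to s$ implies $\lambda x.r\hookrightarrow\lambda x.s$; $r\hookrightarrow s$ implies $rt\hookrightarrow st$; $r\to s$ implies $tr\hookrightarrow ts$, $r\times t\hookrightarrow s\times t$, $t\times r\hookrightarrow t\times s$; $r\hookrightarrow s$ implies $\pi_A(r)\hookrightarrow\pi_A(s)$. Finally $r\rightsquigarrow s$ iff $r\rightleftarrows^* r'\to s'\rightleftarrows^* s$ for some $r',s'$. -}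

module Defs where

open import Data.Nat using (ℕ; zero; suc; _<ᵇ_; _≡ᵇ_)
open import Data.Bool using (if_then_else_)
open import Data.List using (List; []; _∷_)
open import Data.Product using (∃; ∃-syntax; _×_; _,_)
open import Relation.Binary.Construct.Closure.ReflexiveTransitive using (Star)

infixr 7 _⇒_
infixr 8 _∧_

data Ty : Set where
  τ   : Ty
  _⇒_ : Ty → Ty → Ty
  _∧_ : Ty → Ty → Ty

infix 4 _≡ᵀ_
data _≡ᵀ_ : Ty → Ty → Set where
  ≡-refl  : ∀ {A} → A ≡ᵀ A
  ≡-sym   : ∀ {A B} → A ≡ᵀ B → B ≡ᵀ A
  ≡-trans : ∀ {A B C} → A ≡ᵀ B → B ≡ᵀ C → A ≡ᵀ C
  ≡-⇒     : ∀ {A A' B B'} → A ≡ᵀ A' → B ≡ᵀ B' → A ⇒ B ≡ᵀ A' ⇒ B'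
  ≡-∧     : ∀ {A A' B B'} → A ≡ᵀ A' → B ≡ᵀ B' → A ∧ B ≡ᵀ A' ∧ B'
  ≡-comm  : ∀ {A B} → A ∧ B ≡ᵀ B ∧ A
  ≡-assoc : ∀ {A B C} → A ∧ (B ∧ C) ≡ᵀ (A ∧ B) ∧ C
  ≡-dist  : ∀ {A B C} → A ⇒ (B ∧ C) ≡ᵀ (A ⇒ B) ∧ (A ⇒ C)
  ≡-curry : ∀ {A B C} → (A ∧ B) ⇒ C ≡ᵀ A ⇒ B ⇒ C

-- Preterms (de Bruijn indices; λ and π carry their type annotation)
--   var i      : variable
--   lam A r    : λx^A.r
--   app r s    : r s
--   pair r s   : r × s
--   proj A r   : π_A(r)

data Tm : Set where
  var  : ℕ → Tm
  lam  : Ty → Tm → Tm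
  app  : Tm → Tm → Tm
  pair : Tm → Tm → Tm
  proj : Ty → Tm → Tm

data IsIntro : Tm → Set where
  intro-lam  : ∀ {A r} → IsIntro (lam A r)
  intro-pair : ∀ {r s} → IsIntro (pair r s)

data IsElimOrVar : Tm → Set where
  ev-var  : ∀ {i} → IsElimOrVar (var i)
  ev-app  : ∀ {r s} → IsElimOrVar (app r s)
  ev-proj : ∀ {A r} → IsElimOrVar (proj A r)

shift : ℕ → Tm → Tm
shift c (var i)    = var (if i <ᵇ c then i else suc i)
shift c (lam A r)  = lam A (shift (suc c) r)
shift c (app r s)  = app (shift c r) (shift c s)
shift c (pair r s) = pair (shift c r) (shift c s)
shift c (proj A r) = proj A (shift c r)

substVar : ℕ → Tm → ℕ → Tm
substVar j s i =
  if i <ᵇ j then var i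
  else (if i ≡ᵇ j then s else predVar i)
  where
  predVar : ℕ → Tm
  predVar zero    = var zero
  predVar (suc k) = var k

-- subst j s r = r[s/j], with indices above j lowered by one
subst : ℕ → Tm → Tm → Tm
subst j s (var i)    = substVar j s i
subst j s (lam A r)  = lam A (subst (suc j) (shift 0 s) r)
subst j s (app r t)  = app (subst j s r) (subst j s t)
subst j s (pair r t) = pair (subst j s r) (subst j s t)
subst j s (proj A r) = proj A (subst j s r)

_[_/0] : Tm → Tm → Tm
r [ s /0] = subst 0 s r

infix 4 _∋_∶_ _⊢_∶_
data _∋_∶_ : List Ty → ℕ → Ty → Set where
  here  : ∀ {Γ A} → (A ∷ Γ) ∋ zero ∶ A
  there : ∀ {Γ A B i} → Γ ∋ i ∶ A → (B ∷ Γ) ∋ suc i ∶ A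

data _⊢_∶_ (Γ : List Ty) : Tm → Ty → Set where
  ty-var  : ∀ {i A} → Γ ∋ i ∶ A → Γ ⊢ var i ∶ A
  ty-conv : ∀ {r A B} → Γ ⊢ r ∶ A → A ≡ᵀ B → Γ ⊢ r ∶ B
  ty-lam  : ∀ {r A B} → (A ∷ Γ) ⊢ r ∶ B → Γ ⊢ lam A r ∶ A ⇒ B
  ty-app  : ∀ {r s A B} → Γ ⊢ r ∶ A ⇒ B → Γ ⊢ s ∶ A → Γ ⊢ app r s ∶ B
  ty-pair : ∀ {r s A B} → Γ ⊢ r ∶ A → Γ ⊢ s ∶ B → Γ ⊢ pair r s ∶ A ∧ B
  ty-proj : ∀ {r A B} → Γ ⊢ r ∶ A ∧ B → Γ ⊢ proj A r ∶ A

infix 4 _⇄_ _⇄*_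
data _⇄_ : Tm → Tm → Set where
  ax-comm  : ∀ {r s} → pair r s ⇄ pair s r
  ax-assoc : ∀ {r s t} → pair (pair r s) t ⇄ pair r (pair s t)
  ax-dist  : ∀ {A r s} → lam A (pair r s) ⇄ pair (lam A r) (lam A s)
  ax-curry : ∀ {r s t} → app (app r s) t ⇄ app r (pair s t)
  ⇄-sym    : ∀ {r s} → r ⇄ s → s ⇄ r
  ⇄-lam    : ∀ {A r s} → r ⇄ s → lam A r ⇄ lam A s
  ⇄-appₗ   : ∀ {r s t} → r ⇄ s → app r t ⇄ app s t
  ⇄-appᵣ   : ∀ {r s t} → r ⇄ s → app t r ⇄ app t s
  ⇄-pairₗ  : ∀ {r s t} → r ⇄ s → pair r t ⇄ pair s t
  ⇄-pairᵣ  : ∀ {r s t} → r ⇄ s → pair t r ⇄ pair t s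
  ⇄-proj   : ∀ {A r s} → r ⇄ s → proj A r ⇄ proj A s

_⇄*_ : Tm → Tm → Set
_⇄*_ = Star _⇄_

infix 4 _⊢_→βπζ_ _⊢_→ηδ_ _⊢_↪_ _⊢_⟶_ _⊢_⇝_

data _⊢_→βπζ_ (Γ : List Ty) : Tm → Tm → Set where
  β : ∀ {A r s} → Γ ⊢ s ∶ A → Γ ⊢ app (lam A r) s →βπζ (r [ s /0])
  π : ∀ {A r s} → Γ ⊢ r ∶ A → Γ ⊢ proj A (pair r s) →βπζ r
  ζ : ∀ {r s t} → Γ ⊢ app (pair r s) t →βπζ pair (app r t) (app s t)

data _⊢_→ηδ_ (Γ : List Ty) : Tm → Tm → Set where
  η : ∀ {A B r} → Γ ⊢ r ∶ A ⇒ B → IsElimOrVar r →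
      Γ ⊢ r →ηδ lam A (app (shift 0 r) (var zero))
  δ : ∀ {A B r} → Γ ⊢ r ∶ A ∧ B → IsElimOrVar r →
      Γ ⊢ r →ηδ pair (proj A r) (proj B r)

mutual
  data _⊢_↪_ (Γ : List Ty) : Tm → Tm → Set where
    ↪-βπζ  : ∀ {r s} → Γ ⊢ r →βπζ s → Γ ⊢ r ↪ s
    ↪-lam  : ∀ {A r s} → (A ∷ Γ) ⊢ r ⟶ s → Γ ⊢ lam A r ↪ lam A s
    ↪-appₗ : ∀ {r s t} → Γ ⊢ r ↪ s → Γ ⊢ app r t ↪ app s t
    ↪-appᵣ : ∀ {r s t} → Γ ⊢ r ⟶ s → Γ ⊢ app t r ↪ app t s
    ↪-pairₗ : ∀ {r s t} → Γ ⊢ r ⟶ s → Γ ⊢ pair r t ↪ pair s t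
    ↪-pairᵣ : ∀ {r s t} → Γ ⊢ r ⟶ s → Γ ⊢ pair t r ↪ pair t s
    ↪-proj : ∀ {A r s} → Γ ⊢ r ↪ s → Γ ⊢ proj A r ↪ proj A s

  data _⊢_⟶_ (Γ : List Ty) : Tm → Tm → Set where
    ⟶-ηδ : ∀ {r s} → Γ ⊢ r →ηδ s → Γ ⊢ r ⟶ s
    ⟶-↪  : ∀ {r s} → Γ ⊢ r ↪ s → Γ ⊢ r ⟶ s

_⊢_⇝_ : List Ty → Tm → Tm → Set
Γ ⊢ r ⇝ s = ∃[ r' ] ∃[ s' ] (r ⇄* r' × Γ ⊢ r' ⟶ s' × s' ⇄* s)

module Submission where

-- Every term is either an introduction or an elimination/variable.  An
-- elimination or variable whose type is an arrow or a product is not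
-- normal: it η- resp. δ-expands.  So a normal non-introduction can only be
-- typed by τ itself, and it remains to see that no closed term has type τ.
-- For that we interpret types as sets: τ as the empty set, ⇒ as function
-- space and ∧ as cartesian product.  Equivalent types have logically
-- equivalent interpretations (each axiom of ≡ᵀ is a standard isomorphism
-- of sets), and every typed term denotes an element of its type under any
-- valuation of its free variables; a closed term of type τ would therefore
-- be an element of the empty set.

open import Defs
open import Data.Empty using (⊥)
open import Data.List using (List; []; _∷_)
open import Data.List.Relation.Unary.All using (All; []; _∷_)
open import Data.Product using (_×_; _,_; proj₁; proj₂; swap; curry; uncurry; <_,_>)
open import Data.Product.Function.NonDependent.Propositional using (_×-⇔_)
open import Data.Sum using (_⊎_; inj₁; inj₂)
open import Function using (_∘_)
open import Level using (0ℓ)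
open import Function.Bundles using (_⇔_; mk⇔; Equivalence)
open import Function.Properties.Equivalence using (⇔-isEquivalence)
open import Function.Related.TypeIsomorphisms using (→-cong-⇔)
open import Relation.Binary using (IsEquivalence)
open import Relation.Binary.Construct.Closure.ReflexiveTransitive using (ε)
open import Relation.Nullary using (¬_)

open Equivalence using (to)
open IsEquivalence (⇔-isEquivalence {ℓ = 0ℓ})
  renaming (refl to ⇔-refl; sym to ⇔-sym; trans to ⇔-trans)

⟦_⟧ : Ty → Set
⟦ τ ⟧     = ⊥
⟦ A ⇒ B ⟧ = ⟦ A ⟧ → ⟦ B ⟧
⟦ A ∧ B ⟧ = ⟦ A ⟧ × ⟦ B ⟧

≡ᵀ-sound : ∀ {A B} → A ≡ᵀ B → ⟦ A ⟧ ⇔ ⟦ B ⟧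
≡ᵀ-sound ≡-refl          = ⇔-refl
≡ᵀ-sound (≡-sym e)       = ⇔-sym (≡ᵀ-sound e)
≡ᵀ-sound (≡-trans e f)   = ⇔-trans (≡ᵀ-sound e) (≡ᵀ-sound f)
≡ᵀ-sound (≡-⇒ e f)       = →-cong-⇔ (≡ᵀ-sound e) (≡ᵀ-sound f)
≡ᵀ-sound (≡-∧ e f)       = ≡ᵀ-sound e ×-⇔ ≡ᵀ-sound f
≡ᵀ-sound ≡-comm          = mk⇔ swap swap
≡ᵀ-sound ≡-assoc         = mk⇔ (λ { (a , (b , c)) → (a , b) , c })
                               (λ { ((a , b) , c) → a , (b , c) })
≡ᵀ-sound ≡-dist          = mk⇔ (λ g → proj₁ ∘ g , proj₂ ∘ g) (uncurry <_,_>)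
≡ᵀ-sound ≡-curry         = mk⇔ curry uncurry

Valuation : List Ty → Set
Valuation = All ⟦_⟧

lookup : ∀ {Γ i A} → Γ ∋ i ∶ A → Valuation Γ → ⟦ A ⟧
lookup here      (a ∷ _) = a
lookup (there x) (_ ∷ ρ) = lookup x ρ

⊢-sound : ∀ {Γ r A} → Γ ⊢ r ∶ A → Valuation Γ → ⟦ A ⟧
⊢-sound (ty-var x)    ρ = lookup x ρ
⊢-sound (ty-conv d e) ρ = to (≡ᵀ-sound e) (⊢-sound d ρ)
⊢-sound (ty-lam d)    ρ = λ a → ⊢-sound d (a ∷ ρ)
⊢-sound (ty-app d e)  ρ = ⊢-sound d ρ (⊢-sound e ρ)
⊢-sound (ty-pair d e) ρ = ⊢-sound d ρ , ⊢-sound e ρ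
⊢-sound (ty-proj d)   ρ = proj₁ (⊢-sound d ρ)

no-closed-atom : ∀ {r} → ¬ ([] ⊢ r ∶ τ)
no-closed-atom d = ⊢-sound d []

Normal : List Ty → Tm → Set
Normal Γ r = (s : Tm) → ¬ (Γ ⊢ r ⇝ s)

intro-or-elim : (r : Tm) → IsIntro r ⊎ IsElimOrVar r
intro-or-elim (var _)    = inj₂ ev-var
intro-or-elim (lam _ _)  = inj₁ intro-lam
intro-or-elim (app _ _)  = inj₂ ev-app
intro-or-elim (pair _ _) = inj₁ intro-pair
intro-or-elim (proj _ _) = inj₂ ev-proj

⟶⇒⇝ : ∀ {Γ r s} → Γ ⊢ r ⟶ s → Γ ⊢ r ⇝ s
⟶⇒⇝ step = _ , _ , ε , step , ε

normal-elim-atomic : ∀ {Γ r A} → Γ ⊢ r ∶ A → IsElimOrVar r → Normal Γ r →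
                     Γ ⊢ r ∶ τ
normal-elim-atomic {A = τ}     d _  _      = d
normal-elim-atomic {A = _ ⇒ _} d ev normal with () ← normal _ (⟶⇒⇝ (⟶-ηδ (η d ev)))
normal-elim-atomic {A = _ ∧ _} d ev normal with () ← normal _ (⟶⇒⇝ (⟶-ηδ (δ d ev)))

mainTheorem4 : (r : Tm) (A : Ty) → [] ⊢ r ∶ A →
    ((s : Tm) → ¬ ([] ⊢ r ⇝ s)) → IsIntro r
mainTheorem4 r A d normal with intro-or-elim r
... | inj₁ intro = intro
... | inj₂ elim  with () ← no-closed-atom (normal-elim-atomic d elim normal)
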